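{- Let $G=(V,E)$ be a finite simple graph with $n=|V|$ and $m=|E|$, and let $Z\subseteq V$. The stack-based closure procedure described in the context, run on $G$ and $Z$, outputs $\mathrm{cl}(Z)$ and runs in $O(m+n)$ time.
   Context: For $v\in V$, $N(v)$ is the set of neighbors of $v$, $N[v]=N(v)\cup\{v\}$ and $d(v)=|N(v)|$. Zero forcing color change rule: given a set of colored vertices, a colored vertex $u$ with exactly one uncolored neighbor $w$ forces $w$ to become colored. The closure $\mathrm{cl}(S)$ of $S\subseteq V$ is the set of colored vertices obtained by starting with exactly $S$ colored and applying the color change rule until no further vertex can be forced (it is uniquely determined by $S$). Closure procedure: initialize arrays $\mathrm{colored}$ and $\mathrm{count}$ of length $n$ to zero and an empty stack. Set $\mathrm{colored}(v)=1$ for all $v\in Z$. For each $v\in Z$: set $\mathrm{count}(v)=\sum_{y\in N(v)}\mathrm{colored}(y)$, and if $\mathrm{count}(v)=d(v)-1$ push $v$. While the stack is nonempty: pop $u$; let $v$ be a neighbor $y$ of $u$ with $\mathrm{colored}(y)=0$; set $\mathrm{colored}(v)=1$; for each $w\in N(v)$ with $\mathrm{colored}(w)=1$, increase $\mathrm{count}(w)$ by $1$ and if $\mathrm{count}(w)=d(w)-1$ push $w$; then set $\mathrm{count}(v)=\sum_{y\in N(v)}\mathrm{colored}(y)$ and if $\mathrm{count}(v)=d(v)-1$ push $v$. Finally return $\{v:\mathrm{colored}(v)=1\}$. -}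

module Defs where

open import Data.Bool using (Bool; true; false; if_then_else_)
open import Data.Nat using (ℕ; zero; suc; _+_; _≡ᵇ_; ⌊_/2⌋)
open import Data.Fin using (Fin)
open import Data.Fin.Subset as S using (Subset; inside; outside; ⁅_⁆; _∪_; _∉_)
open import Data.List using (List; []; _∷_; allFin; length; map)
open import Data.Nat.ListAction using (sum)
open import Data.List.Membership.Propositional renaming (_∈_ to _∈ₗ_; _∉_ to _∉ₗ_)
open import Data.List.Relation.Unary.Unique.Propositional using (Unique)
open import Data.Vec using (Vec; lookup; replicate; _[_]≔_)
open import Data.Product using (Σ; _×_; ∃₂)
open import Relation.Binary.PropositionalEquality using (_≡_)
open import Relation.Binary.Construct.Closure.ReflexiveTransitive using (Star)
open import Relation.Nullary using (¬_)

record Graph (n : ℕ) : Set where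
  field
    adj        : Fin n → List (Fin n)
    adj-unique : ∀ v → Unique (adj v)
    adj-irrefl : ∀ v → v ∉ₗ adj v
    adj-sym    : ∀ u v → v ∈ₗ adj u → u ∈ₗ adj v
open Graph public

degree : ∀ {n} → Graph n → Fin n → ℕ
degree G v = length (adj G v)

-- m = |E| = (Σ_v d(v)) / 2  (handshake lemma; the sum is always even)
numEdges : ∀ {n} → Graph n → ℕ
numEdges {n} G = ⌊ sum (map (degree G) (allFin n)) /2⌋

Forces : ∀ {n} → Graph n → Subset n → Fin n → Fin n → Set
Forces G C u w =
  (u S.∈ C) × (w ∈ₗ adj G u) × (w ∉ C) × (∀ y → y ∈ₗ adj G u → y ∉ C → y ≡ w)

ForceStep : ∀ {n} → Graph n → Subset n → Subset n → Set
ForceStep G C C′ = ∃₂ λ u w → Forces G C u w × (C′ ≡ C ∪ ⁅ w ⁆)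

Stalled : ∀ {n} → Graph n → Subset n → Set
Stalled G C = ∀ u w → ¬ Forces G C u w

IsClosure : ∀ {n} → Graph n → Subset n → Subset n → Set
IsClosure G S C = Star (ForceStep G) S C × Stalled G C

-- The stack-based closure procedure, as a small-step machine in which
-- every step performs O(1) elementary (word-RAM) operations.
-- The number of machine steps is the running time.

data PC (n : ℕ) : Set where
  degLoop   : List (Fin n) → PC n
  degCount  : Fin n → List (Fin n) → ℕ → List (Fin n) → PC n
  colorLoop : List (Fin n) → PC n
  countLoop : List (Fin n) → PC n
  countSum  : Fin n → List (Fin n) → ℕ → List (Fin n) → PC n
  while     : PC n
  scan      : Fin n → List (Fin n) → PC n
  incr      : Fin n → List (Fin n) → PC n
  sumV      : Fin n → List (Fin n) → ℕ → PC n
  done      : PC n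

record Config (n : ℕ) : Set where
  constructor config
  field
    colored : Subset n
    count   : Vec ℕ n
    deg     : Vec ℕ n
    stack   : List (Fin n)
    pc      : PC n
open Config public

bit : Bool → ℕ
bit true  = 1
bit false = 0

-- push v iff count(v) = d(v) - 1, i.e. 1 + count(v) = d(v)
pushIf : ∀ {n} → Vec ℕ n → Fin n → ℕ → List (Fin n) → List (Fin n)
pushIf d v c st = if suc c ≡ᵇ lookup d v then v ∷ st else st

step : ∀ {n} → Graph n → Subset n → Config n → Config n
step {n} G Z (config col cnt d st (degLoop []))       = config col cnt d st (colorLoop (allFin n))
step G Z (config col cnt d st (degLoop (v ∷ vs)))     = config col cnt d st (degCount v (adj G v) 0 vs)
step G Z (config col cnt d st (degCount v [] a vs))   = config col cnt (d [ v ]≔ a) st (degLoop vs)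
step G Z (config col cnt d st (degCount v (_ ∷ ys) a vs)) = config col cnt d st (degCount v ys (suc a) vs)
step {n} G Z (config col cnt d st (colorLoop []))     = config col cnt d st (countLoop (allFin n))
step G Z (config col cnt d st (colorLoop (v ∷ vs)))   =
  config (if lookup Z v then col [ v ]≔ inside else col) cnt d st (colorLoop vs)
step G Z (config col cnt d st (countLoop []))         = config col cnt d st while
step G Z (config col cnt d st (countLoop (v ∷ vs)))   =
  config col cnt d st (if lookup Z v then countSum v (adj G v) 0 vs else countLoop vs)
step G Z (config col cnt d st (countSum v [] a vs))   =
  config col (cnt [ v ]≔ a) d (pushIf d v a st) (countLoop vs)
step G Z (config col cnt d st (countSum v (y ∷ ys) a vs)) =
  config col cnt d st (countSum v ys (a + bit (lookup col y)) vs)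
step G Z (config col cnt d [] while)                  = config col cnt d [] done
step G Z (config col cnt d (u ∷ st) while)            = config col cnt d st (scan u (adj G u))
step G Z (config col cnt d st (scan u []))            = config col cnt d st while
step G Z (config col cnt d st (scan u (y ∷ ys)))      =
  if lookup col y
  then config col cnt d st (scan u ys)
  else config (col [ y ]≔ inside) cnt d st (incr y (adj G y))
step G Z (config col cnt d st (incr v []))            = config col cnt d st (sumV v (adj G v) 0)
step G Z (config col cnt d st (incr v (w ∷ ws)))      =
  if lookup col w
  then config col (cnt [ w ]≔ suc (lookup cnt w)) d
              (pushIf d w (suc (lookup cnt w)) st) (incr v ws)
  else config col cnt d st (incr v ws)
step G Z (config col cnt d st (sumV v [] a))          =
  config col (cnt [ v ]≔ a) d (pushIf d v a st) while
step G Z (config col cnt d st (sumV v (y ∷ ys) a))    =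
  config col cnt d st (sumV v ys (a + bit (lookup col y)))
step G Z (config col cnt d st done)                   = config col cnt d st done

initConfig : ∀ n → Config n
initConfig n = config (replicate n outside) (replicate n 0) (replicate n 0) [] (degLoop (allFin n))

run : ∀ {n} → Graph n → Subset n → ℕ → Config n → Config n
run G Z zero    c = c
run G Z (suc k) c = run G Z k (step G Z c)

module Submission where

-- The proof has
-- three independent parts.
--  * Closures are unique (`closure-unique`): a colour set reachable from Z
--    by forcing steps is contained in every stalled superset of Z.
--  * Partial correctness (module `Correctness`): an invariant `Inv`, one
--    clause per program point, is preserved by every step.  In the main
--    loop it says that the coloured set is reachable from Z by forcings,
--    every stored count(v) of a coloured v is its number of coloured
--    neighbours, the stack holds only coloured vertices with at most one
--    uncoloured neighbour, and every coloured vertex that can still force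
--    is on the stack.  At `done` the stack is empty, so the set is stalled.
--  * Running time (module `Potential`): a potential Φ on configurations
--    strictly decreases with every step before `done`.  Every vertex holds
--    a budget paying for being coloured, for its count updates and for
--    being popped once; the one push a coloured vertex still awaits is paid
--    for in advance.  The initial potential is at most 26 (n + m + 1),
--    by the handshake bound Σ d(v) ≤ 2m + 1 (`InitialPotential`).

open import Defs
open import Data.Bool using (Bool; true; false; if_then_else_; T)
open import Data.Nat using (ℕ; zero; suc; _+_; _*_; _≡ᵇ_; _<ᵇ_; _≤_; _<_; z≤n; s≤s; ⌊_/2⌋)
open import Data.Nat.Properties
open import Data.Nat.ListAction using (sum)
open import Data.Nat.Tactic.RingSolver using (solve-∀)
open import Data.Fin using (Fin) renaming (zero to fzero; suc to fsuc)
open import Data.Fin.Properties using () renaming (_≟_ to _≟F_; suc-injective to fsuc-injective)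
open import Data.Fin.Subset as S using (Subset; inside; ⁅_⁆; _∪_)
open import Data.Fin.Subset.Properties using (⊆-antisym; x∈p∪q⁻; x∈p∪q⁺; x∈⁅y⁆⇒x≡y; x∈⁅x⁆) renaming (_∈?_ to _∈S?_)
open import Data.List using (List; []; _∷_; length; allFin; map)
import Data.List as List
open import Data.List.Properties using (length-tabulate)
open import Data.List.Membership.Propositional renaming (_∈_ to _∈ₗ_; _∉_ to _∉ₗ_)
open import Data.List.Membership.Propositional.Properties using (∈-allFin)
import Data.List.Membership.DecPropositional as DecMembership
open import Data.List.Relation.Unary.Any using (here; there)
open import Data.List.Relation.Unary.All.Properties using (All¬⇒¬Any)
open import Data.List.Relation.Unary.AllPairs using (_∷_)
open import Data.List.Relation.Unary.Unique.Propositional using (Unique)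
open import Data.Vec using (Vec; lookup; _[_]≔_)
open import Data.Vec.Properties using (lookup-replicate; lookup∘update; lookup∘update′; []=⇒lookup; lookup⇒[]=; tabulate∘lookup; tabulate-cong)
open import Data.Product using (Σ; _×_; _,_; proj₁; proj₂)
open import Data.Sum using (_⊎_; inj₁; inj₂)
open import Data.Empty using (⊥; ⊥-elim)
open import Data.Unit using (tt)
open import Relation.Binary.PropositionalEquality
open import Relation.Binary.Construct.Closure.ReflexiveTransitive using (Star; ε; _◅_; _◅◅_)
open import Relation.Nullary using (¬_; yes; no)
open import Function using (_∘_)

forcing-extends : ∀ {n} {G : Graph n} {S C : Subset n} → Star (ForceStep G) S C → S S.⊆ C
forcing-extends ε x∈S = x∈S
forcing-extends {G = G} {S = S} ((u , w , _ , refl) ◅ r) x∈S =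
  forcing-extends {G = G} r (x∈p∪q⁺ {p = S} {q = ⁅ w ⁆} (inj₁ x∈S))

-- A stalled superset X of S absorbs every forcing chain from S: the vertex
-- forced by u ∈ X is also the only neighbour of u outside X, so it lies in X.
forcing-stays-in-stalled : ∀ {n} {G : Graph n} {S C X : Subset n} →
  Star (ForceStep G) S C → S S.⊆ X → Stalled G X → C S.⊆ X
forcing-stays-in-stalled ε S⊆X stalled = S⊆X
forcing-stays-in-stalled {G = G} {S = S} {X = X} ((u , w , (u∈S , w∈N , _ , unique) , refl) ◅ r) S⊆X stalled =
  forcing-stays-in-stalled {G = G} r S∪w⊆X stalled
  where
  S∪w⊆X : (S ∪ ⁅ w ⁆) S.⊆ X
  S∪w⊆X {x} p with x∈p∪q⁻ S ⁅ w ⁆ p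
  ... | inj₁ x∈S = S⊆X x∈S
  ... | inj₂ x∈w rewrite x∈⁅y⁆⇒x≡y w x∈w with w ∈S? X
  ...   | yes w∈X = w∈X
  ...   | no w∉X = ⊥-elim (stalled u w (S⊆X u∈S , w∈N , w∉X , λ y y∈N y∉X → unique y y∈N (y∉X ∘ S⊆X)))

closure-unique : ∀ {n} {G : Graph n} {Z C D : Subset n} → IsClosure G Z C → IsClosure G Z D → C ≡ D
closure-unique {G = G} (reachC , stalledC) (reachD , stalledD) =
  ⊆-antisym (forcing-stays-in-stalled {G = G} reachC (forcing-extends {G = G} reachD) stalledD)
            (forcing-stays-in-stalled {G = G} reachD (forcing-extends {G = G} reachC) stalledC)

true≢false : true ≢ false
true≢false ()

if-cases : ∀ {A : Set} b (x y : A) →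
  (T b × (if b then x else y) ≡ x) ⊎ (¬ T b × (if b then x else y) ≡ y)
if-cases true  x y = inj₁ (tt , refl)
if-cases false x y = inj₂ ((λ ()) , refl)

lookup-ext : ∀ {A : Set} {k} (u v : Vec A k) → (∀ i → lookup u i ≡ lookup v i) → u ≡ v
lookup-ext u v same = trans (sym (tabulate∘lookup u)) (trans (tabulate-cong same) (tabulate∘lookup v))

ΣF : ∀ {k} → (Fin k → ℕ) → ℕ
ΣF {zero}  f = 0
ΣF {suc k} f = f fzero + ΣF (f ∘ fsuc)

ΣF-cong : ∀ {k} (f g : Fin k → ℕ) → (∀ i → f i ≡ g i) → ΣF f ≡ ΣF g
ΣF-cong {zero}  f g eq = refl
ΣF-cong {suc k} f g eq = cong₂ _+_ (eq fzero) (ΣF-cong (f ∘ fsuc) (g ∘ fsuc) (eq ∘ fsuc))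

ΣF-mono : ∀ {k} (f g : Fin k → ℕ) → (∀ i → f i ≤ g i) → ΣF f ≤ ΣF g
ΣF-mono {zero}  f g le = z≤n
ΣF-mono {suc k} f g le = +-mono-≤ (le fzero) (ΣF-mono (f ∘ fsuc) (g ∘ fsuc) (le ∘ fsuc))

ΣF-scale : ∀ {k} m (h : Fin k → ℕ) → ΣF (λ v → m * suc (h v)) ≡ m * (k + ΣF h)
ΣF-scale {zero}  m h = sym (*-zeroʳ m)
ΣF-scale {suc k} m h rewrite ΣF-scale m (h ∘ fsuc) = distrib m k (h fzero) (ΣF (h ∘ fsuc))
  where distrib : ∀ m k a r → m * suc a + m * (k + r) ≡ m * (suc k + (a + r))
        distrib = solve-∀

ΣF-exchange : ∀ {k} (f f' : Fin k → ℕ) i → (∀ j → j ≢ i → f j ≡ f' j) → ΣF f' + f i ≡ ΣF f + f' i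
ΣF-exchange {suc k} f f' fzero same = begin
    (f' fzero + ΣF (f' ∘ fsuc)) + f fzero ≡⟨ cong (λ t → (f' fzero + t) + f fzero) (sym tails) ⟩
    (f' fzero + ΣF (f ∘ fsuc)) + f fzero  ≡⟨ swap (f' fzero) (ΣF (f ∘ fsuc)) (f fzero) ⟩
    (f fzero + ΣF (f ∘ fsuc)) + f' fzero  ∎
  where
  open ≡-Reasoning
  swap : ∀ a b c → (a + b) + c ≡ (c + b) + a
  swap = solve-∀
  tails : ΣF (f ∘ fsuc) ≡ ΣF (f' ∘ fsuc)
  tails = ΣF-cong _ _ (λ j → same (fsuc j) (λ ()))
ΣF-exchange {suc k} f f' (fsuc i) same = begin
    (f' fzero + ΣF (f' ∘ fsuc)) + f (fsuc i) ≡⟨ +-assoc (f' fzero) _ _ ⟩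
    f' fzero + (ΣF (f' ∘ fsuc) + f (fsuc i)) ≡⟨ cong₂ _+_ (sym (same fzero (λ ()))) tail ⟩
    f fzero + (ΣF (f ∘ fsuc) + f' (fsuc i))  ≡⟨ sym (+-assoc (f fzero) _ _) ⟩
    (f fzero + ΣF (f ∘ fsuc)) + f' (fsuc i)  ∎
  where
  open ≡-Reasoning
  tail : ΣF (f' ∘ fsuc) + f (fsuc i) ≡ ΣF (f ∘ fsuc) + f' (fsuc i)
  tail = ΣF-exchange (f ∘ fsuc) (f' ∘ fsuc) i (λ j j≢i → same (fsuc j) (j≢i ∘ fsuc-injective))

ΣF-local-bound : ∀ {k} (f f' : Fin k → ℕ) i P E → (∀ j → j ≢ i → f j ≡ f' j) →
  f' i + P ≤ f i + E → ΣF f' + P ≤ ΣF f + E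
ΣF-local-bound f f' i P E same local = +-cancelʳ-≤ (f i) _ _ (begin
    (ΣF f' + P) + f i  ≡⟨ swap (ΣF f') P (f i) ⟩
    (ΣF f' + f i) + P  ≡⟨ cong (_+ P) (ΣF-exchange f f' i same) ⟩
    (ΣF f + f' i) + P  ≡⟨ +-assoc (ΣF f) _ _ ⟩
    ΣF f + (f' i + P)  ≤⟨ +-monoʳ-≤ (ΣF f) local ⟩
    ΣF f + (f i + E)   ≡⟨ regroup (ΣF f) (f i) E ⟩
    (ΣF f + E) + f i   ∎)
  where
  open ≤-Reasoning
  swap : ∀ a b c → (a + b) + c ≡ (a + c) + b
  swap = solve-∀
  regroup : ∀ a b c → a + (b + c) ≡ (a + c) + b
  regroup = solve-∀

sum-tabulate : ∀ {A : Set} {k} (f : A → ℕ) (g : Fin k → A) → sum (map f (List.tabulate g)) ≡ ΣF (f ∘ g)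
sum-tabulate {k = zero}  f g = refl
sum-tabulate {k = suc k} f g = cong (f (g fzero) +_) (sum-tabulate f (g ∘ fsuc))

module _ {n : ℕ} where

  Colored : Subset n → Fin n → Set
  Colored c v = lookup c v ≡ true

  nColored : Subset n → List (Fin n) → ℕ
  nColored c []       = 0
  nColored c (y ∷ ys) = bit (lookup c y) + nColored c ys

  nColored≤length : ∀ c xs → nColored c xs ≤ length xs
  nColored≤length c [] = z≤n
  nColored≤length c (x ∷ xs) with lookup c x
  ... | true  = s≤s (nColored≤length c xs)
  ... | false = m≤n⇒m≤1+n (nColored≤length c xs)

  full⇒allColored : ∀ c xs → nColored c xs ≡ length xs → ∀ y → y ∈ₗ xs → Colored c y
  full⇒allColored c (x ∷ xs) eq y y∈ with lookup c x in cx
  full⇒allColored c (x ∷ xs) eq y (here refl) | true = cx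
  full⇒allColored c (x ∷ xs) eq y (there y∈) | true = full⇒allColored c xs (suc-injective eq) y y∈
  full⇒allColored c (x ∷ xs) eq y y∈ | false =
    ⊥-elim (<-irrefl refl (≤-trans (≤-reflexive (sym eq)) (nColored≤length c xs)))

  allColored⇒full : ∀ c xs → (∀ y → y ∈ₗ xs → Colored c y) → nColored c xs ≡ length xs
  allColored⇒full c [] all = refl
  allColored⇒full c (x ∷ xs) all rewrite all x (here refl) =
    cong suc (allColored⇒full c xs (λ y y∈ → all y (there y∈)))

  -- Exactly one uncoloured entry w in a duplicate-free list means the
  -- coloured count is length - 1 (this is why count(v) = d(v) - 1 is tested).
  oneUncolored⇒count : ∀ c xs → Unique xs → ∀ w → w ∈ₗ xs → lookup c w ≡ false →
    (∀ y → y ∈ₗ xs → lookup c y ≡ false → y ≡ w) → suc (nColored c xs) ≡ length xs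
  oneUncolored⇒count c (x ∷ xs) (x∉xs ∷ uniq) w w∈ w-unc only with lookup c x in cx
  ... | true with w∈
  ...   | here refl = ⊥-elim (true≢false (trans (sym cx) w-unc))
  ...   | there w∈xs = cong suc (oneUncolored⇒count c xs uniq w w∈xs w-unc (λ y y∈ → only y (there y∈)))
  oneUncolored⇒count c (x ∷ xs) (x∉xs ∷ uniq) w w∈ w-unc only | false =
    cong suc (allColored⇒full c xs rest-colored)
    where
    rest-colored : ∀ y → y ∈ₗ xs → Colored c y
    rest-colored y y∈ with lookup c y in cy
    ... | true  = refl
    ... | false = ⊥-elim (All¬⇒¬Any x∉xs (subst (_∈ₗ xs) (trans (only y (there y∈) cy) (sym (only x (here refl) cx))) y∈))

  count⇒atMostOne : ∀ c xs → suc (nColored c xs) ≡ length xs → ∀ y z → y ∈ₗ xs → z ∈ₗ xs →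
    lookup c y ≡ false → lookup c z ≡ false → y ≡ z
  count⇒atMostOne c (x ∷ xs) eq y z y∈ z∈ y-unc z-unc with lookup c x in cx
  count⇒atMostOne c (x ∷ xs) eq y z (here refl) z∈ y-unc z-unc | true = ⊥-elim (true≢false (trans (sym cx) y-unc))
  count⇒atMostOne c (x ∷ xs) eq y z (there y∈) (here refl) y-unc z-unc | true = ⊥-elim (true≢false (trans (sym cx) z-unc))
  count⇒atMostOne c (x ∷ xs) eq y z (there y∈) (there z∈) y-unc z-unc | true =
    count⇒atMostOne c xs (suc-injective eq) y z y∈ z∈ y-unc z-unc
  count⇒atMostOne c (x ∷ xs) eq y z (here refl) (here refl) y-unc z-unc | false = refl
  count⇒atMostOne c (x ∷ xs) eq y z (here refl) (there z∈) y-unc z-unc | false =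
    ⊥-elim (true≢false (trans (sym (full⇒allColored c xs (suc-injective eq) z z∈)) z-unc))
  count⇒atMostOne c (x ∷ xs) eq y z (there y∈) z∈ y-unc z-unc | false =
    ⊥-elim (true≢false (trans (sym (full⇒allColored c xs (suc-injective eq) y y∈)) y-unc))

  paint : Subset n → Fin n → Subset n
  paint c y = c [ y ]≔ inside

  paint-other : ∀ c y x → x ≢ y → lookup (paint c y) x ≡ lookup c x
  paint-other c y x x≢y = lookup∘update′ x≢y c true

  paint-colored : ∀ c y x → Colored c x → Colored (paint c y) x
  paint-colored c y x cx with x ≟F y
  ... | yes refl = lookup∘update y c true
  ... | no x≢y   = trans (paint-other c y x x≢y) cx

  paint-uncolored : ∀ c y x → lookup (paint c y) x ≡ false → lookup c x ≡ false
  paint-uncolored c y x ux with x ≟F y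
  ... | yes refl = ⊥-elim (true≢false (trans (sym (lookup∘update y c true)) ux))
  ... | no x≢y   = trans (sym (paint-other c y x x≢y)) ux

  paint≡∪ : ∀ c y → paint c y ≡ c ∪ ⁅ y ⁆
  paint≡∪ c y = ⊆-antisym ⊆∪ ∪⊆
    where
    ⊆∪ : paint c y S.⊆ (c ∪ ⁅ y ⁆)
    ⊆∪ {x} p with x ≟F y
    ... | yes refl = x∈p∪q⁺ (inj₂ (x∈⁅x⁆ x))
    ... | no x≢y   = x∈p∪q⁺ (inj₁ (lookup⇒[]= x c (trans (sym (paint-other c y x x≢y)) ([]=⇒lookup p))))
    ∪⊆ : (c ∪ ⁅ y ⁆) S.⊆ paint c y
    ∪⊆ {x} p with x∈p∪q⁻ c ⁅ y ⁆ p
    ... | inj₁ x∈c = lookup⇒[]= x (paint c y) (paint-colored c y x ([]=⇒lookup x∈c))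
    ... | inj₂ x∈y rewrite x∈⁅y⁆⇒x≡y y x∈y = lookup⇒[]= y (paint c y) (lookup∘update y c true)

  -- colouring y raises the count of a list by one exactly when y is an
  -- uncoloured entry; this is what `incr` performs on the neighbours of y
  nColored-paint-outside : ∀ c y xs → y ∉ₗ xs → nColored (paint c y) xs ≡ nColored c xs
  nColored-paint-outside c y [] y∉ = refl
  nColored-paint-outside c y (x ∷ xs) y∉ =
    cong₂ _+_ (cong bit (paint-other c y x (λ e → y∉ (here (sym e)))))
              (nColored-paint-outside c y xs (y∉ ∘ there))

  nColored-paint-inside : ∀ c y xs → Unique xs → y ∈ₗ xs → lookup c y ≡ false →
    nColored (paint c y) xs ≡ suc (nColored c xs)
  nColored-paint-inside c y (x ∷ xs) (x∉xs ∷ uniq) (here refl) y-unc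
    rewrite lookup∘update x c true | y-unc = cong suc (nColored-paint-outside c x xs (All¬⇒¬Any x∉xs))
  nColored-paint-inside c y (x ∷ xs) (x∉xs ∷ uniq) (there y∈) y-unc with x ≟F y
  ... | yes refl = ⊥-elim (All¬⇒¬Any x∉xs y∈)
  ... | no x≢y rewrite paint-other c y x x≢y =
    trans (cong (bit (lookup c x) +_) (nColored-paint-inside c y xs uniq y∈ y-unc)) (+-suc _ _)

  ∉⇒uncolored : ∀ (c : Subset n) x → ¬ (x S.∈ c) → lookup c x ≡ false
  ∉⇒uncolored c x x∉ with lookup c x in cx
  ... | true  = ⊥-elim (x∉ (lookup⇒[]= x c cx))
  ... | false = refl

  uncolored⇒∉ : ∀ (c : Subset n) x → lookup c x ≡ false → ¬ (x S.∈ c)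
  uncolored⇒∉ c x ux x∈ = true≢false (trans (sym ([]=⇒lookup x∈)) ux)

module Correctness {n : ℕ} (G : Graph n) (Z : Subset n) where
  open DecMembership {A = Fin n} _≟F_ using () renaming (_∈?_ to _∈ₗ?_)

  N : Fin n → List (Fin n)
  N = adj G

  CanForce : Subset n → Fin n → Set
  CanForce c u = Σ (Fin n) λ w → w ∈ₗ N u × lookup c w ≡ false ×
                   (∀ y → y ∈ₗ N u → lookup c y ≡ false → y ≡ w)

  AtMostOneUncolored : Subset n → Fin n → Set
  AtMostOneUncolored c u = ∀ y z → y ∈ₗ N u → z ∈ₗ N u → lookup c y ≡ false → lookup c z ≡ false → y ≡ z

  -- every vertex on the stack is coloured with at most one uncoloured
  -- neighbour, so the vertex it colours when popped is really forced
  StackSound : Subset n → List (Fin n) → Set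
  StackSound c st = ∀ u → u ∈ₗ st → Colored c u × AtMostOneUncolored c u

  canForce-unpaint : ∀ c y w → y ∉ₗ N w → CanForce (paint c y) w → CanForce c w
  canForce-unpaint c y w y∉ (x , x∈ , x-unc , only) =
    x , x∈ , paint-uncolored c y x x-unc ,
    λ z z∈ z-unc → only z z∈ (trans (paint-other c y z (λ e → y∉ (subst (_∈ₗ N w) e z∈))) z-unc)

  stackSound-paint : ∀ c y st → StackSound c st → StackSound (paint c y) st
  stackSound-paint c y st sound u u∈ =
    paint-colored c y u (proj₁ (sound u u∈)) ,
    λ a b a∈ b∈ a-unc b-unc → proj₂ (sound u u∈) a b a∈ b∈ (paint-uncolored c y a a-unc) (paint-uncolored c y b b-unc)

  DegreesOK : Vec ℕ n → Set
  DegreesOK d = ∀ x → lookup d x ≡ degree G x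

  record PushSpec (c : Subset n) (v : Fin n) (st st' : List (Fin n)) : Set where
    field
      sound  : StackSound c st'
      pushed : CanForce c v → v ∈ₗ st'
      kept   : ∀ u → u ∈ₗ st → u ∈ₗ st'
  open PushSpec using (pushed; kept)

  pushIf-spec : ∀ c (d : Vec ℕ n) v a st → StackSound c st → Colored c v → lookup d v ≡ degree G v →
    a ≡ nColored c (N v) → PushSpec c v st (pushIf d v a st)
  pushIf-spec c d v a st sound cv dv av with if-cases (suc a ≡ᵇ lookup d v) (v ∷ st) st
  ... | inj₁ (test , e) rewrite e = record
    { sound  = λ { u (here refl) → cv , count⇒atMostOne c (N v) (trans (cong suc (sym av)) (trans (≡ᵇ⇒≡ _ _ test) dv))
                 ; u (there u∈) → sound u u∈ }
    ; pushed = λ _ → here refl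
    ; kept   = λ u → there }
  ... | inj₂ (¬test , e) rewrite e = record
    { sound  = sound
    ; pushed = λ { (w , w∈ , w-unc , only) → ⊥-elim (¬test (≡⇒≡ᵇ _ _
                 (trans (cong suc av) (trans (oneUncolored⇒count c (N v) (adj-unique G v) w w∈ w-unc only) (sym dv))))) }
    ; kept   = λ u u∈ → u∈ }

  CountOK : Subset n → Vec ℕ n → Fin n → Set
  CountOK c cnt w = lookup cnt w ≡ nColored c (N w)

  Reached : Subset n → Set
  Reached c = Star (ForceStep G) Z c

  -- From `while` on
  -- the colouring is reachable from Z, the stack is sound, counts of
  -- coloured vertices are correct except for the vertices still being
  -- processed, and every coloured vertex that can force is on the stack
  -- or is still being processed.
  Inv : Config n → Set
  Inv (config col cnt d st (degLoop vs)) =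
    (∀ x → lookup col x ≡ false) × st ≡ [] × (∀ x → x ∉ₗ vs → lookup d x ≡ degree G x)
  Inv (config col cnt d st (degCount v ys a vs)) =
    (∀ x → lookup col x ≡ false) × st ≡ [] × (a + length ys ≡ degree G v) ×
    (∀ x → x ∉ₗ v ∷ vs → lookup d x ≡ degree G x)
  Inv (config col cnt d st (colorLoop vs)) =
    st ≡ [] × DegreesOK d × (∀ x → Colored col x → Colored Z x) × (∀ x → x ∉ₗ vs → lookup Z x ≡ lookup col x)
  Inv (config col cnt d st (countLoop vs)) =
    col ≡ Z × DegreesOK d × StackSound col st ×
    (∀ w → Colored col w → w ∈ₗ vs ⊎ CountOK col cnt w) ×
    (∀ w → Colored col w → CanForce col w → w ∈ₗ st ⊎ w ∈ₗ vs)
  Inv (config col cnt d st (countSum v ys a vs)) =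
    col ≡ Z × DegreesOK d × StackSound col st × Colored col v ×
    (a + nColored col ys ≡ nColored col (N v)) ×
    (∀ w → Colored col w → w ≢ v → w ∈ₗ vs ⊎ CountOK col cnt w) ×
    (∀ w → Colored col w → CanForce col w → w ∈ₗ st ⊎ (w ≡ v ⊎ w ∈ₗ vs))
  Inv (config col cnt d st while) =
    Reached col × DegreesOK d × StackSound col st ×
    (∀ w → Colored col w → CountOK col cnt w) ×
    (∀ w → Colored col w → CanForce col w → w ∈ₗ st)
  Inv (config col cnt d st (scan u ys)) =
    Reached col × DegreesOK d × StackSound col st × Colored col u × AtMostOneUncolored col u ×
    (∀ y → y ∈ₗ ys → y ∈ₗ N u) × (∀ y → y ∈ₗ N u → lookup col y ≡ false → y ∈ₗ ys) ×
    (∀ w → Colored col w → CountOK col cnt w) ×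
    (∀ w → Colored col w → CanForce col w → w ∈ₗ st ⊎ w ≡ u)
  -- v was just coloured; the counts of its coloured neighbours in ws are
  -- one too small
  Inv (config col cnt d st (incr v ws)) =
    Reached col × DegreesOK d × StackSound col st × Colored col v × v ∉ₗ ws × Unique ws ×
    (∀ w → Colored col w → w ≢ v →
       (w ∈ₗ ws → suc (lookup cnt w) ≡ nColored col (N w)) × (w ∉ₗ ws → CountOK col cnt w)) ×
    (∀ w → Colored col w → CanForce col w → w ∈ₗ st ⊎ (w ∈ₗ ws ⊎ w ≡ v))
  Inv (config col cnt d st (sumV v ys a)) =
    Reached col × DegreesOK d × StackSound col st × Colored col v ×
    (a + nColored col ys ≡ nColored col (N v)) ×
    (∀ w → Colored col w → w ≢ v → CountOK col cnt w) ×
    (∀ w → Colored col w → CanForce col w → w ∈ₗ st ⊎ w ≡ v)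
  Inv (config col cnt d st done) = Reached col × Stalled G col

  colorLoop-step : ∀ col cnt d st v vs b → lookup Z v ≡ b → Inv (config col cnt d st (colorLoop (v ∷ vs))) →
    Inv (config (if b then col [ v ]≔ inside else col) cnt d st (colorLoop vs))
  colorLoop-step col cnt d st v vs true zv (st≡[] , dOK , ⊆Z , copied) = st≡[] , dOK , ⊆Z' , copied'
    where
    ⊆Z' : ∀ x → Colored (paint col v) x → Colored Z x
    ⊆Z' x cx with x ≟F v
    ... | yes refl = zv
    ... | no x≢v   = ⊆Z x (trans (sym (paint-other col v x x≢v)) cx)
    copied' : ∀ x → x ∉ₗ vs → lookup Z x ≡ lookup (paint col v) x
    copied' x x∉ with x ≟F v
    ... | yes refl = trans zv (sym (lookup∘update v col true))
    ... | no x≢v   = trans (copied x (λ { (here e) → x≢v e ; (there x∈) → x∉ x∈ })) (sym (paint-other col v x x≢v))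
  colorLoop-step col cnt d st v vs false zv (st≡[] , dOK , ⊆Z , copied) = st≡[] , dOK , ⊆Z , copied'
    where
    copied' : ∀ x → x ∉ₗ vs → lookup Z x ≡ lookup col x
    copied' x x∉ with x ≟F v
    copied' x x∉ | yes refl with lookup col x in cx
    ... | true  = ⊆Z x cx
    ... | false = zv
    copied' x x∉ | no x≢v = copied x (λ { (here e) → x≢v e ; (there x∈) → x∉ x∈ })

  countLoop-step : ∀ col cnt d st v vs b → lookup Z v ≡ b → Inv (config col cnt d st (countLoop (v ∷ vs))) →
    Inv (config col cnt d st (if b then countSum v (N v) 0 vs else countLoop vs))
  countLoop-step col cnt d st v vs true zv (col≡Z , dOK , sound , counts , stacked) =
    col≡Z , dOK , sound , trans (cong (λ c → lookup c v) col≡Z) zv , refl , counts' , stacked'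
    where
    counts' : ∀ w → Colored col w → w ≢ v → w ∈ₗ vs ⊎ CountOK col cnt w
    counts' w cw w≢v with counts w cw
    ... | inj₁ (here e)   = ⊥-elim (w≢v e)
    ... | inj₁ (there w∈) = inj₁ w∈
    ... | inj₂ ok         = inj₂ ok
    stacked' : ∀ w → Colored col w → CanForce col w → w ∈ₗ st ⊎ (w ≡ v ⊎ w ∈ₗ vs)
    stacked' w cw f with stacked w cw f
    ... | inj₁ w∈st       = inj₁ w∈st
    ... | inj₂ (here e)   = inj₂ (inj₁ e)
    ... | inj₂ (there w∈) = inj₂ (inj₂ w∈)
  countLoop-step col cnt d st v vs false zv (col≡Z , dOK , sound , counts , stacked) =
    col≡Z , dOK , sound , counts' , stacked'
    where
    v-uncolored : ∀ w → Colored col w → w ≡ v → ⊥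
    v-uncolored w cw refl = true≢false (trans (sym cw) (trans (cong (λ c → lookup c w) col≡Z) zv))
    counts' : ∀ w → Colored col w → w ∈ₗ vs ⊎ CountOK col cnt w
    counts' w cw with counts w cw
    ... | inj₁ (here e)   = ⊥-elim (v-uncolored w cw e)
    ... | inj₁ (there w∈) = inj₁ w∈
    ... | inj₂ ok         = inj₂ ok
    stacked' : ∀ w → Colored col w → CanForce col w → w ∈ₗ st ⊎ w ∈ₗ vs
    stacked' w cw f with stacked w cw f
    ... | inj₁ w∈st       = inj₁ w∈st
    ... | inj₂ (here e)   = ⊥-elim (v-uncolored w cw e)
    ... | inj₂ (there w∈) = inj₂ w∈

  -- Finding the uncoloured neighbour y of the popped vertex u is a forcing
  -- step u → y, since u has no other uncoloured neighbour.
  scan-step : ∀ col cnt d st u y ys b → lookup col y ≡ b → Inv (config col cnt d st (scan u (y ∷ ys))) →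
    Inv (if b then config col cnt d st (scan u ys) else config (col [ y ]≔ inside) cnt d st (incr y (N y)))
  scan-step col cnt d st u y ys true cy (reach , dOK , sound , cu , one , ⊆N , unc∈ , counts , stacked) =
    reach , dOK , sound , cu , one , (λ z z∈ → ⊆N z (there z∈)) , unc∈' , counts , stacked
    where
    unc∈' : ∀ z → z ∈ₗ N u → lookup col z ≡ false → z ∈ₗ ys
    unc∈' z z∈ z-unc with unc∈ z z∈ z-unc
    ... | here refl = ⊥-elim (true≢false (trans (sym cy) z-unc))
    ... | there z∈ys = z∈ys
  scan-step col cnt d st u y ys false y-unc (reach , dOK , sound , cu , one , ⊆N , unc∈ , counts , stacked) =
    reach' , dOK , stackSound-paint col y st sound , lookup∘update y col true ,
    adj-irrefl G y , adj-unique G y , counts' , stacked'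
    where
    col' = paint col y
    y∈Nu : y ∈ₗ N u
    y∈Nu = ⊆N y (here refl)
    forces : Forces G col u y
    forces = lookup⇒[]= u col cu , y∈Nu , uncolored⇒∉ col y y-unc ,
             λ z z∈ z∉ → one z y z∈ y∈Nu (∉⇒uncolored col z z∉) y-unc
    reach' : Reached col'
    reach' = reach ◅◅ ((u , y , forces , paint≡∪ col y) ◅ ε)
    unpaint : ∀ w → Colored col' w → w ≢ y → Colored col w
    unpaint w cw w≢y = trans (sym (paint-other col y w w≢y)) cw
    counts' : ∀ w → Colored col' w → w ≢ y →
      (w ∈ₗ N y → suc (lookup cnt w) ≡ nColored col' (N w)) × (w ∉ₗ N y → CountOK col' cnt w)
    counts' w cw w≢y =
      (λ w∈ → trans (cong suc (counts w (unpaint w cw w≢y)))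
                    (sym (nColored-paint-inside col y (N w) (adj-unique G w) (adj-sym G y w w∈) y-unc))) ,
      (λ w∉ → trans (counts w (unpaint w cw w≢y))
                    (sym (nColored-paint-outside col y (N w) (λ y∈ → w∉ (adj-sym G w y y∈)))))
    stacked' : ∀ w → Colored col' w → CanForce col' w → w ∈ₗ st ⊎ (w ∈ₗ N y ⊎ w ≡ y)
    stacked' w cw f with w ≟F y
    ... | yes w≡y = inj₂ (inj₂ w≡y)
    ... | no w≢y with w ∈ₗ? N y
    ...   | yes w∈ = inj₂ (inj₁ w∈)
    ...   | no w∉ with stacked w (unpaint w cw w≢y) (canForce-unpaint col y w (λ y∈ → w∉ (adj-sym G w y y∈)) f)
    ...     | inj₁ w∈st = inj₁ w∈st
    ...     | inj₂ refl = ⊥-elim (w∉ (adj-sym G u y y∈Nu))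

  incr-step : ∀ col cnt d st v w ws b → lookup col w ≡ b → Inv (config col cnt d st (incr v (w ∷ ws))) →
    Inv (if b then config col (cnt [ w ]≔ suc (lookup cnt w)) d (pushIf d w (suc (lookup cnt w)) st) (incr v ws)
              else config col cnt d st (incr v ws))
  incr-step col cnt d st v w ws true cw (reach , dOK , sound , cv , v∉ , (w∉ws ∷ uniq) , counts , stacked) =
    reach , dOK , PushSpec.sound push , cv , v∉ ∘ there , uniq , counts' , stacked'
    where
    w≢v : w ≢ v
    w≢v e = v∉ (here (sym e))
    c1 = suc (lookup cnt w)
    cnt' = cnt [ w ]≔ c1
    c1-correct : c1 ≡ nColored col (N w)
    c1-correct = proj₁ (counts w cw w≢v) (here refl)
    push = pushIf-spec col d w c1 st sound cw (dOK w) c1-correct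
    counts' : ∀ x → Colored col x → x ≢ v →
      (x ∈ₗ ws → suc (lookup cnt' x) ≡ nColored col (N x)) × (x ∉ₗ ws → CountOK col cnt' x)
    counts' x cx x≢v with x ≟F w
    ... | yes refl = (λ x∈ → ⊥-elim (All¬⇒¬Any w∉ws x∈)) , (λ _ → trans (lookup∘update x cnt c1) c1-correct)
    ... | no x≢w rewrite lookup∘update′ x≢w cnt c1 =
      (λ x∈ → proj₁ (counts x cx x≢v) (there x∈)) ,
      (λ x∉ → proj₂ (counts x cx x≢v) (λ { (here e) → x≢w e ; (there x∈) → x∉ x∈ }))
    stacked' : ∀ x → Colored col x → CanForce col x → x ∈ₗ pushIf d w c1 st ⊎ (x ∈ₗ ws ⊎ x ≡ v)
    stacked' x cx f with stacked x cx f
    ... | inj₁ x∈st               = inj₁ (kept push x x∈st)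
    ... | inj₂ (inj₁ (here refl)) = inj₁ (pushed push f)
    ... | inj₂ (inj₁ (there x∈))  = inj₂ (inj₁ x∈)
    ... | inj₂ (inj₂ x≡v)         = inj₂ (inj₂ x≡v)
  incr-step col cnt d st v w ws false w-unc (reach , dOK , sound , cv , v∉ , (w∉ws ∷ uniq) , counts , stacked) =
    reach , dOK , sound , cv , v∉ ∘ there , uniq , counts' , stacked'
    where
    not-w : ∀ x → Colored col x → x ≡ w → ⊥
    not-w x cx refl = true≢false (trans (sym cx) w-unc)
    counts' : ∀ x → Colored col x → x ≢ v →
      (x ∈ₗ ws → suc (lookup cnt x) ≡ nColored col (N x)) × (x ∉ₗ ws → CountOK col cnt x)
    counts' x cx x≢v =
      (λ x∈ → proj₁ (counts x cx x≢v) (there x∈)) ,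
      (λ x∉ → proj₂ (counts x cx x≢v) (λ { (here e) → not-w x cx e ; (there x∈) → x∉ x∈ }))
    stacked' : ∀ x → Colored col x → CanForce col x → x ∈ₗ st ⊎ (x ∈ₗ ws ⊎ x ≡ v)
    stacked' x cx f with stacked x cx f
    ... | inj₁ x∈st              = inj₁ x∈st
    ... | inj₂ (inj₁ (here e))   = ⊥-elim (not-w x cx e)
    ... | inj₂ (inj₁ (there x∈)) = inj₂ (inj₁ x∈)
    ... | inj₂ (inj₂ x≡v)        = inj₂ (inj₂ x≡v)

  inv-step : ∀ c → Inv c → Inv (step G Z c)
  inv-step (config col cnt d st (degLoop [])) (uncol , st≡[] , dOK) =
    st≡[] , (λ x → dOK x (λ ())) , (λ x cx → ⊥-elim (true≢false (trans (sym cx) (uncol x)))) ,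
    (λ x x∉ → ⊥-elim (x∉ (∈-allFin x)))
  inv-step (config col cnt d st (degLoop (v ∷ vs))) (uncol , st≡[] , dOK) = uncol , st≡[] , refl , dOK
  inv-step (config col cnt d st (degCount v [] a vs)) (uncol , st≡[] , a≡d , dOK) = uncol , st≡[] , dOK'
    where
    dOK' : ∀ x → x ∉ₗ vs → lookup (d [ v ]≔ a) x ≡ degree G x
    dOK' x x∉ with x ≟F v
    ... | yes refl = trans (lookup∘update x d a) (trans (sym (+-identityʳ a)) a≡d)
    ... | no x≢v   = trans (lookup∘update′ x≢v d a) (dOK x (λ { (here e) → x≢v e ; (there x∈) → x∉ x∈ }))
  inv-step (config col cnt d st (degCount v (_ ∷ ys) a vs)) (uncol , st≡[] , a≡d , dOK) =
    uncol , st≡[] , trans (sym (+-suc a (length ys))) a≡d , dOK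
  inv-step (config col cnt d st (colorLoop [])) (st≡[] , dOK , ⊆Z , copied) =
    col≡Z , dOK , subst (StackSound col) (sym st≡[]) (λ u ()) ,
    (λ w _ → inj₁ (∈-allFin w)) , (λ w _ _ → inj₂ (∈-allFin w))
    where
    col≡Z : col ≡ Z
    col≡Z = lookup-ext col Z (λ i → sym (copied i (λ ())))
  inv-step (config col cnt d st (colorLoop (v ∷ vs))) inv = colorLoop-step col cnt d st v vs (lookup Z v) refl inv
  inv-step (config col cnt d st (countLoop [])) (col≡Z , dOK , sound , counts , stacked) =
    subst Reached (sym col≡Z) ε , dOK , sound , (λ w cw → done-counting (counts w cw)) ,
    (λ w cw f → done-stacking (stacked w cw f))
    where
    done-counting : ∀ {w} → w ∈ₗ [] ⊎ CountOK col cnt w → CountOK col cnt w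
    done-counting (inj₂ ok) = ok
    done-stacking : ∀ {w} → w ∈ₗ st ⊎ w ∈ₗ [] → w ∈ₗ st
    done-stacking (inj₁ w∈st) = w∈st
  inv-step (config col cnt d st (countLoop (v ∷ vs))) inv = countLoop-step col cnt d st v vs (lookup Z v) refl inv
  inv-step (config col cnt d st (countSum v [] a vs)) (col≡Z , dOK , sound , cv , a-sum , counts , stacked) =
    col≡Z , dOK , PushSpec.sound push , counts' , stacked'
    where
    a-correct : a ≡ nColored col (N v)
    a-correct = trans (sym (+-identityʳ a)) a-sum
    push = pushIf-spec col d v a st sound cv (dOK v) a-correct
    counts' : ∀ w → Colored col w → w ∈ₗ vs ⊎ CountOK col (cnt [ v ]≔ a) w
    counts' w cw with w ≟F v
    ... | yes refl = inj₂ (trans (lookup∘update w cnt a) a-correct)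
    ... | no w≢v with counts w cw w≢v
    ...   | inj₁ w∈ = inj₁ w∈
    ...   | inj₂ ok = inj₂ (trans (lookup∘update′ w≢v cnt a) ok)
    stacked' : ∀ w → Colored col w → CanForce col w → w ∈ₗ pushIf d v a st ⊎ w ∈ₗ vs
    stacked' w cw f with stacked w cw f
    ... | inj₁ w∈st        = inj₁ (kept push w w∈st)
    ... | inj₂ (inj₁ refl) = inj₁ (pushed push f)
    ... | inj₂ (inj₂ w∈)   = inj₂ w∈
  inv-step (config col cnt d st (countSum v (y ∷ ys) a vs)) (col≡Z , dOK , sound , cv , a-sum , counts , stacked) =
    col≡Z , dOK , sound , cv , trans (+-assoc a _ _) a-sum , counts , stacked
  -- an empty stack means no coloured vertex can force: the colouring is stalled
  inv-step (config col cnt d [] while) (reach , dOK , sound , counts , stacked) =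
    reach , λ u w (u∈ , w∈ , w∉ , only) →
      no-member (stacked u ([]=⇒lookup u∈) (w , w∈ , ∉⇒uncolored col w w∉ , λ y y∈ y-unc → only y y∈ (uncolored⇒∉ col y y-unc)))
    where
    no-member : ∀ {u : Fin n} → u ∈ₗ [] → ⊥
    no-member ()
  inv-step (config col cnt d (u ∷ st) while) (reach , dOK , sound , counts , stacked) =
    reach , dOK , (λ x x∈ → sound x (there x∈)) , proj₁ (sound u (here refl)) , proj₂ (sound u (here refl)) ,
    (λ y y∈ → y∈) , (λ y y∈ _ → y∈) , counts , stacked'
    where
    stacked' : ∀ w → Colored col w → CanForce col w → w ∈ₗ st ⊎ w ≡ u
    stacked' w cw f with stacked w cw f
    ... | here w≡u   = inj₂ w≡u
    ... | there w∈st = inj₁ w∈st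
  -- a popped vertex whose neighbours are all coloured cannot force any more
  inv-step (config col cnt d st (scan u [])) (reach , dOK , sound , cu , one , ⊆N , unc∈ , counts , stacked) =
    reach , dOK , sound , counts , stacked'
    where
    stacked' : ∀ w → Colored col w → CanForce col w → w ∈ₗ st
    stacked' w cw f with stacked w cw f
    ... | inj₁ w∈st = w∈st
    ... | inj₂ refl with f
    ...   | (x , x∈ , x-unc , _) with unc∈ x x∈ x-unc
    ...     | ()
  inv-step (config col cnt d st (scan u (y ∷ ys))) inv = scan-step col cnt d st u y ys (lookup col y) refl inv
  inv-step (config col cnt d st (incr v [])) (reach , dOK , sound , cv , v∉ , uniq , counts , stacked) =
    reach , dOK , sound , cv , refl , (λ w cw w≢v → proj₂ (counts w cw w≢v) (λ ())) , stacked'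
    where
    stacked' : ∀ w → Colored col w → CanForce col w → w ∈ₗ st ⊎ w ≡ v
    stacked' w cw f with stacked w cw f
    ... | inj₁ w∈st       = inj₁ w∈st
    ... | inj₂ (inj₂ w≡v) = inj₂ w≡v
  inv-step (config col cnt d st (incr v (w ∷ ws))) inv = incr-step col cnt d st v w ws (lookup col w) refl inv
  inv-step (config col cnt d st (sumV v [] a)) (reach , dOK , sound , cv , a-sum , counts , stacked) =
    reach , dOK , PushSpec.sound push , counts' , stacked'
    where
    a-correct : a ≡ nColored col (N v)
    a-correct = trans (sym (+-identityʳ a)) a-sum
    push = pushIf-spec col d v a st sound cv (dOK v) a-correct
    counts' : ∀ w → Colored col w → CountOK col (cnt [ v ]≔ a) w
    counts' w cw with w ≟F v
    ... | yes refl = trans (lookup∘update w cnt a) a-correct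
    ... | no w≢v   = trans (lookup∘update′ w≢v cnt a) (counts w cw w≢v)
    stacked' : ∀ w → Colored col w → CanForce col w → w ∈ₗ pushIf d v a st
    stacked' w cw f with stacked w cw f
    ... | inj₁ w∈st = kept push w w∈st
    ... | inj₂ refl = pushed push f
  inv-step (config col cnt d st (sumV v (y ∷ ys) a)) (reach , dOK , sound , cv , a-sum , counts , stacked) =
    reach , dOK , sound , cv , trans (+-assoc a _ _) a-sum , counts , stacked
  inv-step (config col cnt d st done) inv = inv

  inv-init : Inv (initConfig n)
  inv-init = (λ x → lookup-replicate x false) , refl , (λ x x∉ → ⊥-elim (x∉ (∈-allFin x)))

  inv-run : ∀ k c → Inv c → Inv (run G Z k c)
  inv-run zero    c inv = inv
  inv-run (suc k) c inv = inv-run k (step G Z c) (inv-step c inv)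

  halted⇒closure : ∀ c → pc c ≡ done → Inv c → IsClosure G Z (colored c)
  halted⇒closure (config col cnt d st .done) refl inv = inv

onlyIf : Bool → ℕ → ℕ
onlyIf b x = if b then x else 0

onlyIf≤ : ∀ b x → onlyIf b x ≤ x
onlyIf≤ true  x = ≤-refl
onlyIf≤ false x = z≤n

onlyIf-exclusive : ∀ c d x → onlyIf (suc c <ᵇ d) x + onlyIf (suc c ≡ᵇ d) x ≤ x
onlyIf-exclusive c d x with suc c <ᵇ d in lt | suc c ≡ᵇ d in eq
... | true  | true  = ⊥-elim (<-irrefl (≡ᵇ⇒≡ (suc c) d (subst T (sym eq) tt)) (<ᵇ⇒< (suc c) d (subst T (sym lt) tt)))
... | true  | false = ≤-reflexive (+-identityʳ x)
... | false | true  = ≤-refl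
... | false | false = z≤n

-- Incrementing c: the token still pending after the increment, plus the
-- one spent on the push, is covered by the token pending before.
onlyIf-increment : ∀ c d x → onlyIf (suc (suc c) <ᵇ d) x + onlyIf (suc (suc c) ≡ᵇ d) x ≤ onlyIf (suc c <ᵇ d) x
onlyIf-increment c d x with suc c <ᵇ d in lt
... | true = onlyIf-exclusive (suc c) d x
... | false with suc (suc c) <ᵇ d in lt′ | suc (suc c) ≡ᵇ d in eq′
...   | true  | _     = ⊥-elim (¬lt (<-trans (n<1+n _) (<ᵇ⇒< _ _ (subst T (sym lt′) tt))))
  where ¬lt : ¬ (suc c < d)
        ¬lt c+1<d = subst T lt (<⇒<ᵇ c+1<d)
...   | false | true  = ⊥-elim (¬lt (subst (suc c <_) (≡ᵇ⇒≡ _ _ (subst T (sym eq′) tt)) (n<1+n _)))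
  where ¬lt : ¬ (suc c < d)
        ¬lt c+1<d = subst T lt (<⇒<ᵇ c+1<d)
...   | false | false = z≤n

module Potential {n : ℕ} (G : Graph n) (Z : Subset n) where

  δ : Fin n → ℕ
  δ v = degree G v

  -- popping v and scanning N(v): d(v) + 2 steps
  popCost : Fin n → ℕ
  popCost v = suc (suc (δ v))

  -- what an uncoloured v holds: the steps of colouring it (the `incr` and
  -- `sumV` loops), one possible push right away, and one pending push
  colorBudget : Fin n → ℕ
  colorBudget v = suc (suc (δ v + δ v + popCost v + popCost v))

  -- a coloured v with count(v) + 1 < d(v) may still be pushed once
  pending : Vec ℕ n → Vec ℕ n → Fin n → ℕ
  pending cnt d v = onlyIf (suc (lookup cnt v) <ᵇ lookup d v) (popCost v)

  budget : Subset n → Vec ℕ n → Vec ℕ n → Fin n → ℕ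
  budget col cnt d v = if lookup col v then pending cnt d v else colorBudget v

  -- every vertex on the stack will be popped
  stackPot : List (Fin n) → ℕ
  stackPot st = sum (map popCost st)

  mainPot : Subset n → Vec ℕ n → Vec ℕ n → List (Fin n) → ℕ
  mainPot col cnt d st = suc (ΣF (budget col cnt d) + stackPot st)

  mainPotMax : List (Fin n) → ℕ
  mainPotMax st = suc (ΣF colorBudget + stackPot st)

  -- the counting loop spends d(v) + 1 steps on v ∈ Z and may push v
  countCost : Fin n → ℕ
  countCost v = suc (if lookup Z v then suc (δ v + popCost v) else 0)

  countLoopPot : List (Fin n) → ℕ
  countLoopPot vs = suc (sum (map countCost vs))

  -- the degree loop also spends d(v) + 2 steps per vertex
  degLoopPot : List (Fin n) → ℕ
  degLoopPot vs = sum (map popCost vs)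

  countLoopPot₀ : ℕ
  countLoopPot₀ = countLoopPot (allFin n)

  Φ : Config n → ℕ
  Φ (config col cnt d st (degLoop vs)) = degLoopPot vs + (suc (suc (length (allFin n))) + (countLoopPot₀ + mainPotMax st))
  Φ (config col cnt d st (degCount v ys a vs)) =
    suc (length ys) + (degLoopPot vs + (suc (suc (length (allFin n))) + (countLoopPot₀ + mainPotMax st)))
  Φ (config col cnt d st (colorLoop vs)) = suc (length vs) + (countLoopPot₀ + mainPotMax st)
  Φ (config col cnt d st (countLoop vs)) = countLoopPot vs + mainPot col cnt d st
  Φ (config col cnt d st (countSum v ys a vs)) = suc (length ys) + (popCost v + (countLoopPot vs + mainPot col cnt d st))
  Φ (config col cnt d st while) = mainPot col cnt d st
  Φ (config col cnt d st (scan u ys)) = suc (length ys) + mainPot col cnt d st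
  Φ (config col cnt d st (incr v ws)) = suc (length ws) + (suc (δ v) + (popCost v + mainPot col cnt d st))
  Φ (config col cnt d st (sumV v ys a)) = suc (length ys) + (popCost v + mainPot col cnt d st)
  Φ (config col cnt d st done) = 0

  stackPot-pushIf : ∀ d v a st → stackPot (pushIf d v a st) ≡ onlyIf (suc a ≡ᵇ lookup d v) (popCost v) + stackPot st
  stackPot-pushIf d v a st with suc a ≡ᵇ lookup d v
  ... | true  = refl
  ... | false = refl

  budget≤colorBudget : ∀ col cnt d v → budget col cnt d v ≤ colorBudget v
  budget≤colorBudget col cnt d v with lookup col v
  ... | false = ≤-refl
  ... | true  = ≤-trans (onlyIf≤ _ (popCost v)) (m≤n+m (popCost v) (suc (suc (δ v + δ v + popCost v))))

  budget-setCount : ∀ col cnt d st v a →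
    ΣF (budget col (cnt [ v ]≔ a) d) + stackPot (pushIf d v a st) ≤ popCost v + (ΣF (budget col cnt d) + stackPot st)
  budget-setCount col cnt d st v a = begin
      ΣF b' + stackPot (pushIf d v a st) ≡⟨ cong (ΣF b' +_) (stackPot-pushIf d v a st) ⟩
      ΣF b' + (P + stackPot st)          ≡⟨ sym (+-assoc (ΣF b') P _) ⟩
      (ΣF b' + P) + stackPot st          ≤⟨ +-monoˡ-≤ (stackPot st) (ΣF-local-bound b b' v P (popCost v) same local) ⟩
      (ΣF b + popCost v) + stackPot st   ≡⟨ regroup (ΣF b) (popCost v) (stackPot st) ⟩
      popCost v + (ΣF b + stackPot st)   ∎
    where
    open ≤-Reasoning
    b  = budget col cnt d
    b' = budget col (cnt [ v ]≔ a) d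
    P  = onlyIf (suc a ≡ᵇ lookup d v) (popCost v)
    regroup : ∀ x y z → (x + y) + z ≡ y + (x + z)
    regroup = solve-∀
    same : ∀ j → j ≢ v → b j ≡ b' j
    same j j≢v rewrite lookup∘update′ j≢v cnt a = refl
    local : b' v + P ≤ b v + popCost v
    local with lookup col v
    ... | true rewrite lookup∘update v cnt a = ≤-trans (onlyIf-exclusive a (lookup d v) (popCost v)) (m≤n+m _ _)
    ... | false = +-monoʳ-≤ (colorBudget v) (onlyIf≤ _ (popCost v))

  -- count(w)++ for coloured w, with its possible push, is prepaid.
  budget-increment : ∀ col cnt d st w → lookup col w ≡ true →
    ΣF (budget col (cnt [ w ]≔ suc (lookup cnt w)) d) + stackPot (pushIf d w (suc (lookup cnt w)) st)
      ≤ ΣF (budget col cnt d) + stackPot st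
  budget-increment col cnt d st w cw = begin
      ΣF b' + stackPot (pushIf d w c1 st) ≡⟨ cong (ΣF b' +_) (stackPot-pushIf d w c1 st) ⟩
      ΣF b' + (P + stackPot st)           ≡⟨ sym (+-assoc (ΣF b') P _) ⟩
      (ΣF b' + P) + stackPot st           ≤⟨ +-monoˡ-≤ (stackPot st) (ΣF-local-bound b b' w P 0 same local) ⟩
      (ΣF b + 0) + stackPot st            ≡⟨ cong (_+ stackPot st) (+-identityʳ _) ⟩
      ΣF b + stackPot st                  ∎
    where
    open ≤-Reasoning
    c1 = suc (lookup cnt w)
    b  = budget col cnt d
    b' = budget col (cnt [ w ]≔ c1) d
    P  = onlyIf (suc c1 ≡ᵇ lookup d w) (popCost w)
    same : ∀ j → j ≢ w → b j ≡ b' j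
    same j j≢w rewrite lookup∘update′ j≢w cnt c1 = refl
    local : b' w + P ≤ b w + 0
    local rewrite cw | lookup∘update w cnt c1 | +-identityʳ (pending cnt d w) =
      onlyIf-increment (lookup cnt w) (lookup d w) (popCost w)

  -- Colouring y releases enough to run `incr` and `sumV` on y.
  budget-paint : ∀ col cnt d y → lookup col y ≡ false →
    ΣF (budget (col [ y ]≔ inside) cnt d) + (suc (δ y) + (suc (δ y) + popCost y)) ≤ ΣF (budget col cnt d) + 0
  budget-paint col cnt d y y-unc = ΣF-local-bound b b' y _ 0 same local
    where
    b  = budget col cnt d
    b' = budget (col [ y ]≔ inside) cnt d
    same : ∀ j → j ≢ y → b j ≡ b' j
    same j j≢y rewrite lookup∘update′ j≢y col inside = refl
    spend : ∀ p a d → p ≤ d → p + (suc a + (suc a + d)) ≤ suc (suc (a + a + d + d)) + 0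
    spend p a d p≤d = ≤-trans (+-monoˡ-≤ (suc a + (suc a + d)) p≤d) (≤-reflexive (regroup a d))
      where regroup : ∀ a d → d + (suc a + (suc a + d)) ≡ suc (suc (a + a + d + d)) + 0
            regroup = solve-∀
    local : b' y + (suc (δ y) + (suc (δ y) + popCost y)) ≤ b y + 0
    local rewrite y-unc | lookup∘update y col inside = spend (pending cnt d y) (δ y) (popCost y) (onlyIf≤ _ (popCost y))

  countLoop-decreases : ∀ col cnt d st v vs b → lookup Z v ≡ b →
    suc (Φ (config col cnt d st (if b then countSum v (adj G v) 0 vs else countLoop vs)))
      ≤ Φ (config col cnt d st (countLoop (v ∷ vs)))
  countLoop-decreases col cnt d st v vs true zv rewrite zv =
    ≤-reflexive (regroup (δ v) (sum (map countCost vs)) (mainPot col cnt d st))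
    where regroup : ∀ a l m → suc (suc a + (suc (suc a) + (suc l + m))) ≡ suc (suc (suc (a + suc (suc a))) + l) + m
          regroup = solve-∀
  countLoop-decreases col cnt d st v vs false zv rewrite zv = ≤-refl

  scan-decreases : ∀ col cnt d st u y ys b → lookup col y ≡ b →
    suc (Φ (if b then config col cnt d st (scan u ys) else config (col [ y ]≔ inside) cnt d st (incr y (adj G y))))
      ≤ Φ (config col cnt d st (scan u (y ∷ ys)))
  scan-decreases col cnt d st u y ys true  cy    = ≤-refl
  scan-decreases col cnt d st u y ys false y-unc = s≤s (begin
      suc (δ y) + (suc (δ y) + (popCost y + suc (ΣF b' + stackPot st)))
        ≡⟨ regroup (δ y) (popCost y) (ΣF b') (stackPot st) ⟩
      suc ((ΣF b' + (suc (δ y) + (suc (δ y) + popCost y))) + stackPot st)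
        ≤⟨ s≤s (+-monoˡ-≤ (stackPot st) (budget-paint col cnt d y y-unc)) ⟩
      suc ((ΣF (budget col cnt d) + 0) + stackPot st)
        ≡⟨ cong (λ z → suc (z + stackPot st)) (+-identityʳ _) ⟩
      mainPot col cnt d st
        ≤⟨ m≤n+m _ (length ys) ⟩
      length ys + mainPot col cnt d st
        ≤⟨ n≤1+n _ ⟩
      suc (length ys + mainPot col cnt d st) ∎)
    where
    open ≤-Reasoning
    b' = budget (col [ y ]≔ inside) cnt d
    regroup : ∀ a p x s → suc a + (suc a + (p + suc (x + s))) ≡ suc ((x + (suc a + (suc a + p))) + s)
    regroup = solve-∀

  incr-decreases : ∀ col cnt d st v w ws b → lookup col w ≡ b →
    suc (Φ (if b then config col (cnt [ w ]≔ suc (lookup cnt w)) d (pushIf d w (suc (lookup cnt w)) st) (incr v ws)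
                 else config col cnt d st (incr v ws)))
      ≤ Φ (config col cnt d st (incr v (w ∷ ws)))
  incr-decreases col cnt d st v w ws true cw =
    s≤s (s≤s (+-monoʳ-≤ (length ws) (s≤s (+-monoʳ-≤ (δ v) (+-monoʳ-≤ (popCost v) (s≤s (budget-increment col cnt d st w cw)))))))
  incr-decreases col cnt d st v w ws false w-unc = ≤-refl

  setCount-absorbed : ∀ c x y p → x ≤ p + y → suc (c + suc x) ≤ suc (p + (c + suc y))
  setCount-absorbed c x y p x≤ = s≤s (≤-trans (+-monoʳ-≤ c (s≤s x≤)) (≤-reflexive (regroup c y p)))
    where regroup : ∀ c y p → c + suc (p + y) ≡ p + (c + suc y)
          regroup = solve-∀

  Φ-decreases : ∀ c → pc c ≡ done ⊎ suc (Φ (step G Z c)) ≤ Φ c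
  Φ-decreases (config col cnt d st (degLoop [])) = inj₂ ≤-refl
  Φ-decreases (config col cnt d st (degLoop (v ∷ vs))) =
    inj₂ (≤-reflexive (cong (λ z → suc (suc z)) (sym (+-assoc (δ v) (degLoopPot vs) _))))
  Φ-decreases (config col cnt d st (degCount v [] a vs)) = inj₂ ≤-refl
  Φ-decreases (config col cnt d st (degCount v (_ ∷ ys) a vs)) = inj₂ ≤-refl
  Φ-decreases (config col cnt d st (colorLoop [])) =
    inj₂ (s≤s (+-monoʳ-≤ countLoopPot₀ (s≤s (+-monoˡ-≤ (stackPot st) (ΣF-mono _ _ (budget≤colorBudget col cnt d))))))
  Φ-decreases (config col cnt d st (colorLoop (v ∷ vs))) = inj₂ ≤-refl
  Φ-decreases (config col cnt d st (countLoop [])) = inj₂ ≤-refl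
  Φ-decreases (config col cnt d st (countLoop (v ∷ vs))) = inj₂ (countLoop-decreases col cnt d st v vs (lookup Z v) refl)
  Φ-decreases (config col cnt d st (countSum v [] a vs)) =
    inj₂ (setCount-absorbed (countLoopPot vs) _ _ (popCost v) (budget-setCount col cnt d st v a))
  Φ-decreases (config col cnt d st (countSum v (y ∷ ys) a vs)) = inj₂ ≤-refl
  Φ-decreases (config col cnt d [] while) = inj₂ (s≤s z≤n)
  Φ-decreases (config col cnt d (u ∷ st) while) = inj₂ (≤-reflexive (regroup (δ u) (ΣF (budget col cnt d)) (stackPot st)))
    where regroup : ∀ a x y → suc (suc a + suc (x + y)) ≡ suc (x + (suc (suc a) + y))
          regroup = solve-∀
  Φ-decreases (config col cnt d st (scan u [])) = inj₂ ≤-refl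
  Φ-decreases (config col cnt d st (scan u (y ∷ ys))) = inj₂ (scan-decreases col cnt d st u y ys (lookup col y) refl)
  Φ-decreases (config col cnt d st (incr v [])) = inj₂ ≤-refl
  Φ-decreases (config col cnt d st (incr v (w ∷ ws))) = inj₂ (incr-decreases col cnt d st v w ws (lookup col w) refl)
  Φ-decreases (config col cnt d st (sumV v [] a)) =
    inj₂ (setCount-absorbed 0 _ _ (popCost v) (budget-setCount col cnt d st v a))
  Φ-decreases (config col cnt d st (sumV v (y ∷ ys) a)) = inj₂ ≤-refl
  Φ-decreases (config col cnt d st done) = inj₁ refl

  run-stays-done : ∀ k c → pc c ≡ done → pc (run G Z k c) ≡ done
  run-stays-done zero    c halted = halted
  run-stays-done (suc k) (config col cnt d st .done) refl = run-stays-done k (config col cnt d st done) refl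

  run-halts : ∀ k c → Φ c ≤ k → pc (run G Z k c) ≡ done
  run-halts k c Φ≤k with Φ-decreases c
  ... | inj₁ halted = run-stays-done k c halted
  run-halts zero    c Φ≤k | inj₂ dec with ≤-trans dec Φ≤k
  ... | ()
  run-halts (suc k) c Φ≤k | inj₂ dec = run-halts k (step G Z c) (≤-pred (≤-trans dec Φ≤k))

≤-double-half : ∀ s → s ≤ suc (2 * ⌊ s /2⌋)
≤-double-half zero          = z≤n
≤-double-half (suc zero)    = s≤s z≤n
≤-double-half (suc (suc s)) = ≤-trans (s≤s (s≤s (≤-double-half s))) (≤-reflexive (regroup ⌊ s /2⌋))
  where regroup : ∀ h → suc (suc (suc (2 * h))) ≡ suc (2 * suc h)
        regroup = solve-∀

module InitialPotential {n : ℕ} (G : Graph n) (Z : Subset n) where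
  open Potential G Z

  size : ℕ
  size = n + ΣF δ

  ΣF-perVertex : ∀ k {h : Fin n → ℕ} → (∀ v → h v ≤ k * suc (δ v)) → ΣF h ≤ k * size
  ΣF-perVertex k {h} le = ≤-trans (ΣF-mono h _ le) (≤-reflexive (ΣF-scale k δ))

  popCost≤ : ∀ v → popCost v ≤ 2 * suc (δ v)
  popCost≤ v = ≤-trans (m≤m+n _ (δ v)) (≤-reflexive (regroup (δ v)))
    where regroup : ∀ d → suc (suc d) + d ≡ 2 * suc d
          regroup = solve-∀

  countCost≤ : ∀ v → countCost v ≤ 4 * suc (δ v)
  countCost≤ v with lookup Z v
  ... | true  = ≤-trans (m≤m+n _ (δ v + δ v)) (≤-reflexive (regroup (δ v)))
    where regroup : ∀ d → suc (suc (d + suc (suc d))) + (d + d) ≡ 4 * suc d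
          regroup = solve-∀
  ... | false = s≤s z≤n

  colorBudget≤ : ∀ v → colorBudget v ≤ 6 * suc (δ v)
  colorBudget≤ v = ≤-trans (m≤m+n _ (δ v + δ v)) (≤-reflexive (regroup (δ v)))
    where regroup : ∀ d → suc (suc (d + d + suc (suc d) + suc (suc d))) + (d + d) ≡ 6 * suc d
          regroup = solve-∀

  Φ-init≤size : Φ (initConfig n) ≤ 13 * suc size
  Φ-init≤size = begin
      degLoopPot (allFin n) + (suc (suc (length (allFin n))) + (suc (sum (map countCost (allFin n))) + suc (ΣF colorBudget + 0)))
        ≤⟨ +-mono-≤ degLoop≤ (+-mono-≤ (s≤s (s≤s length≤)) (+-mono-≤ (s≤s countLoop≤) (s≤s (+-monoˡ-≤ 0 (ΣF-perVertex 6 colorBudget≤))))) ⟩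
      2 * size + (suc (suc size) + (suc (4 * size) + suc (6 * size + 0)))
        ≡⟨ regroup size ⟩
      13 * size + 4
        ≤⟨ m≤m+n _ 9 ⟩
      13 * size + 4 + 9
        ≡⟨ regroup′ size ⟩
      13 * suc size ∎
    where
    open ≤-Reasoning
    degLoop≤ : degLoopPot (allFin n) ≤ 2 * size
    degLoop≤ = ≤-trans (≤-reflexive (sum-tabulate popCost (λ x → x))) (ΣF-perVertex 2 popCost≤)
    length≤ : length (allFin n) ≤ size
    length≤ = ≤-trans (≤-reflexive (length-tabulate (λ x → x))) (m≤m+n n _)
    countLoop≤ : sum (map countCost (allFin n)) ≤ 4 * size
    countLoop≤ = ≤-trans (≤-reflexive (sum-tabulate countCost (λ x → x))) (ΣF-perVertex 4 countCost≤)
    regroup : ∀ T → 2 * T + (suc (suc T) + (suc (4 * T) + suc (6 * T + 0))) ≡ 13 * T + 4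
    regroup = solve-∀
    regroup′ : ∀ T → 13 * T + 4 + 9 ≡ 13 * suc T
    regroup′ = solve-∀

  -- Σ d(v) ≤ 2m + 1, hence size + 1 ≤ 2 (n + m + 1)
  size≤edges : suc size ≤ 2 * (n + numEdges G + 1)
  size≤edges = begin
      suc (n + ΣF δ)                      ≡⟨ cong (λ s → suc (n + s)) (sym (sum-tabulate δ (λ x → x))) ⟩
      suc (n + degreeSum)                 ≤⟨ s≤s (+-monoʳ-≤ n (≤-double-half degreeSum)) ⟩
      suc (n + suc (2 * numEdges G))      ≤⟨ m≤m+n _ n ⟩
      suc (n + suc (2 * numEdges G)) + n  ≡⟨ regroup n (numEdges G) ⟩
      2 * (n + numEdges G + 1)            ∎
    where
    open ≤-Reasoning
    degreeSum = sum (map (degree G) (allFin n))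
    regroup : ∀ n m → suc (n + suc (2 * m)) + n ≡ 2 * (n + m + 1)
    regroup = solve-∀

  Φ-init-bound : Φ (initConfig n) ≤ 26 * (n + numEdges G + 1)
  Φ-init-bound = begin
      Φ (initConfig n)                ≤⟨ Φ-init≤size ⟩
      13 * suc size                   ≤⟨ *-monoʳ-≤ 13 size≤edges ⟩
      13 * (2 * (n + numEdges G + 1)) ≡⟨ sym (*-assoc 13 2 (n + numEdges G + 1)) ⟩
      26 * (n + numEdges G + 1)       ∎
    where open ≤-Reasoning

proposition1 : Σ ℕ λ c → ∀ n (G : Graph n) (Z : Subset n) →
    let final = run G Z (c * (n + numEdges G + 1)) (initConfig n)
    in (pc final ≡ done)
       × IsClosure G Z (colored final)
       × (∀ C → IsClosure G Z C → C ≡ colored final)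
proposition1 = 26 , result
  where
  result : ∀ n (G : Graph n) (Z : Subset n) →
    let final = run G Z (26 * (n + numEdges G + 1)) (initConfig n)
    in (pc final ≡ done) × IsClosure G Z (colored final) × (∀ C → IsClosure G Z C → C ≡ colored final)
  result n G Z = halted , closure , λ C C-closure → closure-unique {G = G} C-closure closure
    where
    steps = 26 * (n + numEdges G + 1)
    halted : pc (run G Z steps (initConfig n)) ≡ done
    halted = Potential.run-halts G Z steps (initConfig n) (InitialPotential.Φ-init-bound G Z)
    closure : IsClosure G Z (colored (run G Z steps (initConfig n)))
    closure = Correctness.halted⇒closure G Z _ halted
                (Correctness.inv-run G Z steps (initConfig n) (Correctness.inv-init G Z))
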